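{- A graph $G$ is $\gamma\gamma_{\rm cer}$-perfect if and only if $G$ is $P_4$-free.
   Context: All graphs are finite and simple. A graph is $P_4$-free if it has no induced subgraph isomorphic to the path $P_4$ on four vertices. A set $D\subseteq V_G$ is a dominating set of $G$ if every vertex of $V_G-D$ is adjacent to at least one vertex of $D$; $\gamma(G)$ is the minimum cardinality of a dominating set. A set $D\subseteq V_G$ is a certified dominating set of $G$ if $D$ is a dominating set of $G$ and every vertex in $D$ has either zero or at least two neighbors in $V_G-D$; $\gamma_{\rm cer}(G)$ is the minimum cardinality of a certified dominating set of $G$. A graph $G$ is $\gamma\gamma_{\rm cer}$-perfect if $\gamma(H)=\gamma_{\rm cer}(H)$ for every induced connected subgraph $H$ of $G$ with $H\neq K_2$. -}

module Defs where

open import Data.Bool using (Bool; true; false)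
open import Data.Nat using (ℕ; _≤_)
open import Data.Fin using (Fin)
open import Data.Fin.Subset using (Subset; _∈_; _∉_; _⊆_; _∩_; _─_; ∣_∣; Nonempty)
open import Data.Vec using (tabulate)
open import Data.Product using (_×_; ∃; Σ)
open import Data.Sum using (_⊎_)
open import Relation.Nullary using (¬_)
open import Relation.Binary.PropositionalEquality using (_≡_; _≢_)

record Graph (n : ℕ) : Set where
  field
    adj    : Fin n → Fin n → Bool
    sym    : ∀ u v → adj u v ≡ adj v u
    irrefl : ∀ v → adj v v ≡ false

open Graph public

module _ {n : ℕ} (G : Graph n) where

  Adj : Fin n → Fin n → Set
  Adj u v = adj G u v ≡ true

  N : Fin n → Subset n
  N v = tabulate (adj G v)

  -- All notions below refer to the induced subgraph G[S] with vertex set S.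

  data WalkIn (S : Subset n) : Fin n → Fin n → Set where
    here : ∀ {u} → u ∈ S → WalkIn S u u
    step : ∀ {u w v} → u ∈ S → Adj u w → WalkIn S w v → WalkIn S u v

  -- G[S] is connected (connected graphs are nonempty)
  ConnectedIn : Subset n → Set
  ConnectedIn S = Nonempty S × (∀ u v → u ∈ S → v ∈ S → WalkIn S u v)

  IsK2 : Subset n → Set
  IsK2 S = ∣ S ∣ ≡ 2 × (∀ u v → u ∈ S → v ∈ S → u ≢ v → Adj u v)

  DominatingIn : Subset n → Subset n → Set
  DominatingIn S D =
    D ⊆ S × (∀ v → v ∈ S → v ∉ D → Σ (Fin n) λ u → u ∈ D × Adj u v)

  CertifiedDominatingIn : Subset n → Subset n → Set
  CertifiedDominatingIn S D =
    DominatingIn S D ×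
    (∀ v → v ∈ D → ∣ N v ∩ (S ─ D) ∣ ≡ 0 ⊎ 2 ≤ ∣ N v ∩ (S ─ D) ∣)

  IsDominationNumber : Subset n → ℕ → Set
  IsDominationNumber S k =
    (Σ (Subset n) λ D → DominatingIn S D × ∣ D ∣ ≡ k) ×
    (∀ D → DominatingIn S D → k ≤ ∣ D ∣)

  IsCertDominationNumber : Subset n → ℕ → Set
  IsCertDominationNumber S k =
    (Σ (Subset n) λ D → CertifiedDominatingIn S D × ∣ D ∣ ≡ k) ×
    (∀ D → CertifiedDominatingIn S D → k ≤ ∣ D ∣)

  GammaEqGammaCer : Subset n → Set
  GammaEqGammaCer S = ∃ λ k → IsDominationNumber S k × IsCertDominationNumber S k

  GGcerPerfect : Set
  GGcerPerfect = ∀ (S : Subset n) → ConnectedIn S → ¬ IsK2 S → GammaEqGammaCer S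

  InducedP4 : Fin n → Fin n → Fin n → Fin n → Set
  InducedP4 a b c d =
    a ≢ b × a ≢ c × a ≢ d × b ≢ c × b ≢ d × c ≢ d ×
    Adj a b × Adj b c × Adj c d ×
    ¬ Adj a c × ¬ Adj b d × ¬ Adj a d

  P4Free : Set
  P4Free = ∀ a b c d → ¬ InducedP4 a b c d

-- An induced P₄ a–b–c–d is dominated by {b, c}, but every certified dominating
-- set of it contains a, b and c: an end vertex left outside D forces its only
-- neighbour into D with a single neighbour outside D. So γ < γ_cer there.
--
-- Conversely, let G[S] be connected and P₄-free. If some vertex dominates S, it
-- alone is a minimum certified dominating set (it has 0 or at least 2 neighbours
-- outside it, since G[S] ≠ K₂). Otherwise G[S] is the join of two parts, each
-- of at least two vertices, so γ = 2 and a suitable pair (two vertices of one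
-- part, or one of each) is certified. The join is found from any vertex v:
-- P₄-freeness makes the N(v)-neighbourhoods of the non-neighbours of v a chain
-- under inclusion, all nonempty by connectivity, and the vertices of N(v)
-- adjacent to every non-neighbour of v form one part.
module Submission where

open import Data.Bool using (true; false)
import Data.Bool.Properties as Bool
open import Data.Empty using (⊥)
open import Data.Fin using (Fin)
open import Data.Fin.Properties using (_≟_; any?; all?)
open import Data.Fin.Subset
  using (Subset; _∈_; _∉_; _⊆_; _∩_; _∪_; _─_; ⁅_⁆; ∣_∣; Nonempty; Empty)
open import Data.Fin.Subset.Properties
  using ( x∈⁅x⁆; x∈⁅y⁆⇒x≡y; x≢y⇒x∉⁅y⁆; x∉⁅y⁆⇒x≢y; ∣⁅x⁆∣≡1; ∣⊥∣≡0; Empty-unique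
        ; p⊆q⇒∣p∣≤∣q∣; x∈p⇒∣p-x∣<∣p∣; x∈p∧x≢y⇒x∈p-y; x∈p∧x∉q⇒x∈p─q; p─q⊆p
        ; x∈p∩q⁺; x∈p∩q⁻; x∈p∪q⁺; x∈p∪q⁻; _∈?_ )
open import Data.List using (List; []; _∷_; allFin)
open import Data.List.Membership.Propositional using () renaming (_∈_ to _∈ˡ_)
open import Data.List.Membership.Propositional.Properties using (∈-allFin)
open import Data.List.Relation.Unary.Any using (here; there)
open import Data.Nat using (ℕ; _≤_; _+_; z≤n; s≤s)
open import Data.Nat.Properties
  using (≤-trans; ≤-reflexive; ≤-antisym; +-suc; +-monoʳ-≤; n≤1+n; module ≤-Reasoning)
open import Data.Product using (_×_; _,_; proj₁; proj₂; ∃; Σ)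
open import Data.Sum using (_⊎_; inj₁; inj₂; [_,_]′)
import Data.Sum as Sum
open import Data.Vec using ([]; _∷_; here; there)
open import Data.Vec.Properties using (lookup∘tabulate; lookup⇒[]=; []=⇒lookup)
open import Function using (_∘_; id)
open import Function.Bundles using (_⇔_; mk⇔)
open import Relation.Nullary using (¬_; Dec; yes; no; ¬?; contradiction)
open import Relation.Nullary.Decidable using (_×-dec_; _⊎-dec_; _→-dec_; decidable-stable; toSum)
open import Relation.Binary.PropositionalEquality
  using (_≡_; _≢_; refl; sym; trans; subst; cong₂)

open import Defs hiding (sym)

private variable
  n : ℕ
  x y z : Fin n
  p q : Subset n

x∈p─q⇒x∉q : ∀ (p q : Subset n) → x ∈ p ─ q → x ∉ q
x∈p─q⇒x∉q (_ ∷ p) (_ ∷ q) (there x∈p─q) (there x∈q) = x∈p─q⇒x∉q p q x∈p─q x∈q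

∣p∪q∣≤∣p∣+∣q∣ : ∀ (p q : Subset n) → ∣ p ∪ q ∣ ≤ ∣ p ∣ + ∣ q ∣
∣p∪q∣≤∣p∣+∣q∣ [] [] = z≤n
∣p∪q∣≤∣p∣+∣q∣ (true ∷ p) (true ∷ q) =
  s≤s (≤-trans (∣p∪q∣≤∣p∣+∣q∣ p q) (+-monoʳ-≤ ∣ p ∣ (n≤1+n ∣ q ∣)))
∣p∪q∣≤∣p∣+∣q∣ (true ∷ p) (false ∷ q) = s≤s (∣p∪q∣≤∣p∣+∣q∣ p q)
∣p∪q∣≤∣p∣+∣q∣ (false ∷ p) (true ∷ q) =
  ≤-trans (s≤s (∣p∪q∣≤∣p∣+∣q∣ p q)) (≤-reflexive (sym (+-suc ∣ p ∣ ∣ q ∣)))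
∣p∪q∣≤∣p∣+∣q∣ (false ∷ p) (false ∷ q) = ∣p∪q∣≤∣p∣+∣q∣ p q

x∈p⇒1≤∣p∣ : x ∈ p → 1 ≤ ∣ p ∣
x∈p⇒1≤∣p∣ x∈p = ≤-trans (s≤s z≤n) (x∈p⇒∣p-x∣<∣p∣ x∈p)

two-members⇒2≤∣p∣ : x ∈ p → y ∈ p → x ≢ y → 2 ≤ ∣ p ∣
two-members⇒2≤∣p∣ x∈p y∈p x≢y =
  ≤-trans (s≤s (x∈p⇒1≤∣p∣ (x∈p∧x≢y⇒x∈p-y y∈p (x≢y ∘ sym)))) (x∈p⇒∣p-x∣<∣p∣ x∈p)

three-members⇒3≤∣p∣ : x ∈ p → y ∈ p → z ∈ p → x ≢ y → x ≢ z → y ≢ z → 3 ≤ ∣ p ∣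
three-members⇒3≤∣p∣ x∈p y∈p z∈p x≢y x≢z y≢z =
  ≤-trans (s≤s (two-members⇒2≤∣p∣ (x∈p∧x≢y⇒x∈p-y y∈p (x≢y ∘ sym))
                                  (x∈p∧x≢y⇒x∈p-y z∈p (x≢z ∘ sym)) y≢z))
          (x∈p⇒∣p-x∣<∣p∣ x∈p)

Empty⇒∣p∣≡0 : Empty p → ∣ p ∣ ≡ 0
Empty⇒∣p∣≡0 {n} {p} empty = subst (λ p → ∣ p ∣ ≡ 0) (sym (Empty-unique empty)) (∣⊥∣≡0 n)

p⊆⁅x⁆⇒∣p∣≤1 : p ⊆ ⁅ x ⁆ → ∣ p ∣ ≤ 1
p⊆⁅x⁆⇒∣p∣≤1 {x = x} p⊆⁅x⁆ = ≤-trans (p⊆q⇒∣p∣≤∣q∣ p⊆⁅x⁆) (≤-reflexive (∣⁅x⁆∣≡1 x))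

∈⁅x⁆∪⁅y⁆⁺ : z ≡ x ⊎ z ≡ y → z ∈ ⁅ x ⁆ ∪ ⁅ y ⁆
∈⁅x⁆∪⁅y⁆⁺ (inj₁ refl) = x∈p∪q⁺ (inj₁ (x∈⁅x⁆ _))
∈⁅x⁆∪⁅y⁆⁺ (inj₂ refl) = x∈p∪q⁺ (inj₂ (x∈⁅x⁆ _))

∈⁅x⁆∪⁅y⁆⁻ : z ∈ ⁅ x ⁆ ∪ ⁅ y ⁆ → z ≡ x ⊎ z ≡ y
∈⁅x⁆∪⁅y⁆⁻ {x = x} {y} z∈ = Sum.map (x∈⁅y⁆⇒x≡y x) (x∈⁅y⁆⇒x≡y y) (x∈p∪q⁻ ⁅ x ⁆ ⁅ y ⁆ z∈)

∉⁅x⁆∪⁅y⁆ : z ≢ x → z ≢ y → z ∉ ⁅ x ⁆ ∪ ⁅ y ⁆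
∉⁅x⁆∪⁅y⁆ z≢x z≢y z∈ = [ z≢x , z≢y ]′ (∈⁅x⁆∪⁅y⁆⁻ z∈)

p⊆⁅x⁆∪⁅y⁆⇒∣p∣≤2 : p ⊆ ⁅ x ⁆ ∪ ⁅ y ⁆ → ∣ p ∣ ≤ 2
p⊆⁅x⁆∪⁅y⁆⇒∣p∣≤2 {p = p} {x} {y} p⊆ = begin
  ∣ p ∣                 ≤⟨ p⊆q⇒∣p∣≤∣q∣ p⊆ ⟩
  ∣ ⁅ x ⁆ ∪ ⁅ y ⁆ ∣     ≤⟨ ∣p∪q∣≤∣p∣+∣q∣ ⁅ x ⁆ ⁅ y ⁆ ⟩
  ∣ ⁅ x ⁆ ∣ + ∣ ⁅ y ⁆ ∣ ≡⟨ cong₂ _+_ (∣⁅x⁆∣≡1 x) (∣⁅x⁆∣≡1 y) ⟩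
  2                     ∎
  where open ≤-Reasoning

∣⁅x⁆∪⁅y⁆∣≡2 : x ≢ y → ∣ ⁅ x ⁆ ∪ ⁅ y ⁆ ∣ ≡ 2
∣⁅x⁆∪⁅y⁆∣≡2 {x = x} {y} x≢y =
  ≤-antisym (p⊆⁅x⁆∪⁅y⁆⇒∣p∣≤2 {x = x} {y} id) (two-members⇒2≤∣p∣ (∈⁅x⁆∪⁅y⁆⁺ (inj₁ refl)) (∈⁅x⁆∪⁅y⁆⁺ (inj₂ refl)) x≢y)

counterexample-or-all : {P Q : Fin n → Set} → (∀ u → Dec (P u)) → (∀ u → Dec (Q u)) →
                        (∃ λ u → P u × ¬ Q u) ⊎ (∀ u → P u → Q u)
counterexample-or-all P? Q? with any? (λ u → P? u ×-dec ¬? (Q? u))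
... | yes counterexample = inj₁ counterexample
... | no ¬counterexample =
  inj₂ λ u Pu → decidable-stable (Q? u) λ ¬Qu → ¬counterexample (u , Pu , ¬Qu)

module _ {P : Fin n → Set} (P? : ∀ u → Dec (P u)) (_≼_ : Fin n → Fin n → Set)
         (≼-trans : ∀ {x y z} → x ≼ y → y ≼ z → x ≼ z)
         (≼-total : ∀ {x y} → P x → P y → x ≼ y ⊎ y ≼ x) where

  private
    minimum-of : (xs : List (Fin n)) → ∃ P → ∃ λ m → P m × ∀ x → x ∈ˡ xs → P x → m ≼ x
    minimum-of [] (m , Pm) = m , Pm , λ _ ()
    minimum-of (x ∷ xs) ∃P with minimum-of xs ∃P | P? x
    ... | m , Pm , m-min | no ¬Px =
      m , Pm , λ { _ (here refl) Px → contradiction Px ¬Px ; y (there y∈xs) → m-min y y∈xs }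
    ... | m , Pm , m-min | yes Px with ≼-total Pm Px
    ...   | inj₁ m≼x = m , Pm , λ { _ (here refl) _ → m≼x ; y (there y∈xs) → m-min y y∈xs }
    ...   | inj₂ x≼m = x , Px , λ { _ (here refl) _ → [ id , id ]′ (≼-total Px Px)
                                  ; y (there y∈xs) Py → ≼-trans x≼m (m-min y y∈xs Py) }

  minimum : ∃ P → ∃ λ m → P m × ∀ x → P x → m ≼ x
  minimum ∃P = let m , Pm , m-min = minimum-of (allFin n) ∃P in m , Pm , λ x → m-min x (∈-allFin x)

module _ {n : ℕ} (G : Graph n) where

  Adj? : ∀ u v → Dec (Adj G u v)
  Adj? u v = adj G u v Bool.≟ true

  Adj-sym : ∀ {u v} → Adj G u v → Adj G v u
  Adj-sym {u} {v} uv = trans (Graph.sym G v u) uv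

  Adj-irrefl : ∀ {v} → ¬ Adj G v v
  Adj-irrefl {v} vv with trans (sym vv) (irrefl G v)
  ... | ()

  Adj⇒≢ : ∀ {u v} → Adj G u v → u ≢ v
  Adj⇒≢ uv refl = Adj-irrefl uv

  induced-P4 : ∀ {a b c d} → Adj G a b → Adj G b c → Adj G c d →
               ¬ Adj G a c → ¬ Adj G b d → ¬ Adj G a d → InducedP4 G a b c d
  induced-P4 ab bc cd ¬ac ¬bd ¬ad =
    Adj⇒≢ ab , (λ { refl → ¬ad cd }) , (λ { refl → ¬bd (Adj-sym ab) }) ,
    Adj⇒≢ bc , (λ { refl → ¬ad ab }) , Adj⇒≢ cd ,
    ab , bc , cd , ¬ac , ¬bd , ¬ad

  Adj⇒∈N : ∀ {u v} → Adj G u v → v ∈ N G u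
  Adj⇒∈N {u} {v} uv = lookup⇒[]= v (N G u) (trans (lookup∘tabulate (adj G u) v) uv)

  ∈N⇒Adj : ∀ {u v} → v ∈ N G u → Adj G u v
  ∈N⇒Adj {u} {v} v∈N = trans (sym (lookup∘tabulate (adj G u) v)) ([]=⇒lookup v∈N)

  walk-start : ∀ {S u v} → WalkIn G S u v → u ∈ S
  walk-start (here u∈S)     = u∈S
  walk-start (step u∈S _ _) = u∈S

  _++ʷ_ : ∀ {S u v w} → WalkIn G S u v → WalkIn G S v w → WalkIn G S u w
  here _          ++ʷ walk′ = walk′
  step u∈S uv walk ++ʷ walk′ = step u∈S uv (walk ++ʷ walk′)

  reverseʷ : ∀ {S u v} → WalkIn G S u v → WalkIn G S v u
  reverseʷ (here u∈S)          = here u∈S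
  reverseʷ (step u∈S uw walk) = reverseʷ walk ++ʷ step (walk-start walk) (Adj-sym uw) (here u∈S)

  reaching⇒connected : ∀ {S r} → r ∈ S → (∀ {u} → u ∈ S → WalkIn G S u r) → ConnectedIn G S
  reaching⇒connected r∈S walk-to =
    (_ , r∈S) , λ u v u∈S v∈S → walk-to u∈S ++ʷ reverseʷ (walk-to v∈S)

  ∈N∩─⁺ : ∀ {S D x y} → Adj G x y → y ∈ S → y ∉ D → y ∈ N G x ∩ (S ─ D)
  ∈N∩─⁺ xy y∈S y∉D = x∈p∩q⁺ (Adj⇒∈N xy , x∈p∧x∉q⇒x∈p─q y∈S y∉D)

  ∈N∩─⁻ : ∀ {S D x y} → y ∈ N G x ∩ (S ─ D) → Adj G x y × y ∈ S × y ∉ D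
  ∈N∩─⁻ {S} {D} {x} y∈ =
    let y∈N , y∈S─D = x∈p∩q⁻ (N G x) (S ─ D) y∈
    in ∈N⇒Adj y∈N , p─q⊆p S D y∈S─D , x∈p─q⇒x∉q S D y∈S─D

  two-outside-neighbours : ∀ {S D x y z} → y ≢ z →
    Adj G x y → y ∈ S → y ∉ D → Adj G x z → z ∈ S → z ∉ D → 2 ≤ ∣ N G x ∩ (S ─ D) ∣
  two-outside-neighbours y≢z xy y∈S y∉D xz z∈S z∉D =
    two-members⇒2≤∣p∣ (∈N∩─⁺ xy y∈S y∉D) (∈N∩─⁺ xz z∈S z∉D) y≢z

  certified⇒¬unique-outside-neighbour : ∀ {S D x y} → CertifiedDominatingIn G S D → x ∈ D →
    Adj G x y → y ∈ S → y ∉ D → ¬ (∀ {z} → Adj G x z → z ∈ S → z ∉ D → z ≡ y)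
  certified⇒¬unique-outside-neighbour {S} {D} {x} {y} (_ , certified) x∈D xy y∈S y∉D unique =
    [ (λ ∣outside∣≡0 → contradiction (subst (1 ≤_) ∣outside∣≡0 1≤∣outside∣) λ ())
    , (λ 2≤∣outside∣ → contradiction (≤-trans 2≤∣outside∣ ∣outside∣≤1) λ { (s≤s ()) })
    ]′ (certified x x∈D)
    where
    1≤∣outside∣ : 1 ≤ ∣ N G x ∩ (S ─ D) ∣
    1≤∣outside∣ = x∈p⇒1≤∣p∣ (∈N∩─⁺ xy y∈S y∉D)
    ∣outside∣≤1 : ∣ N G x ∩ (S ─ D) ∣ ≤ 1
    ∣outside∣≤1 = p⊆⁅x⁆⇒∣p∣≤1 λ z∈ →
      let xz , z∈S , z∉D = ∈N∩─⁻ z∈ in subst (_∈ ⁅ y ⁆) (sym (unique xz z∈S z∉D)) (x∈⁅x⁆ y)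

  Dominates : Subset n → Fin n → Set
  Dominates S v = v ∈ S × (∀ u → u ∈ S → u ≢ v → Adj G v u)

  Dominates? : ∀ S v → Dec (Dominates S v)
  Dominates? S v = (v ∈? S) ×-dec all? (λ u → (u ∈? S) →-dec ¬? (u ≟ v) →-dec Adj? v u)

  non-neighbour : ∀ {S v} → ¬ Dominates S v → v ∈ S → ∃ λ u → (u ∈ S × u ≢ v) × ¬ Adj G v u
  non-neighbour {S} {v} ¬dominates v∈S
    with counterexample-or-all (λ u → (u ∈? S) ×-dec ¬? (u ≟ v)) (Adj? v)
  ... | inj₁ witness  = witness
  ... | inj₂ adjacent = contradiction (v∈S , λ u u∈S u≢v → adjacent u (u∈S , u≢v)) ¬dominates

  dominating-nonempty : ∀ {S D} → Nonempty S → DominatingIn G S D → Nonempty D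
  dominating-nonempty {D = D} (v , v∈S) (_ , dominated) with v ∈? D
  ... | yes v∈D = v , v∈D
  ... | no v∉D  = let u , u∈D , _ = dominated v v∈S v∉D in u , u∈D

  nonempty⇒1≤γ : ∀ {S D} → Nonempty S → DominatingIn G S D → 1 ≤ ∣ D ∣
  nonempty⇒1≤γ nonempty dominating = x∈p⇒1≤∣p∣ (proj₂ (dominating-nonempty nonempty dominating))

  no-dominating-vertex⇒2≤γ : ∀ {S D} → Nonempty S → (∀ v → ¬ Dominates S v) →
                             DominatingIn G S D → 2 ≤ ∣ D ∣
  no-dominating-vertex⇒2≤γ {S} {D} nonempty no-dominating (D⊆S , dominated)
    with dominating-nonempty nonempty (D⊆S , dominated)
  ... | d , d∈D with counterexample-or-all (_∈? D) (_≟ d)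
  ...   | inj₁ (e , e∈D , e≢d) = two-members⇒2≤∣p∣ e∈D d∈D e≢d
  ...   | inj₂ only-d = contradiction (D⊆S d∈D , d-dominates) (no-dominating d)
    where
    d-dominates : ∀ u → u ∈ S → u ≢ d → Adj G d u
    d-dominates u u∈S u≢d =
      let w , w∈D , wu = dominated u u∈S (u≢d ∘ only-d u)
      in subst (λ w → Adj G w u) (only-d w w∈D) wu

  certified-minimum⇒γ≡γcer : ∀ {S D k} → (∀ D′ → DominatingIn G S D′ → k ≤ ∣ D′ ∣) →
                             CertifiedDominatingIn G S D → ∣ D ∣ ≡ k → GammaEqGammaCer G S
  certified-minimum⇒γ≡γcer {D = D} {k} lower-bound certified ∣D∣≡k =
    k , ((D , proj₁ certified , ∣D∣≡k) , lower-bound) ,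
        ((D , certified , ∣D∣≡k) , λ D′ certified′ → lower-bound D′ (proj₁ certified′))

  dominating-vertex-with-one-other⇒K2 : ∀ {S v u} → Dominates S v → u ∈ S → u ≢ v →
                                         (∀ w → w ∈ S → w ≡ v ⊎ w ≡ u) → IsK2 G S
  dominating-vertex-with-one-other⇒K2 {S} (v∈S , v-dominates) u∈S u≢v v-or-u =
    ≤-antisym (p⊆⁅x⁆∪⁅y⁆⇒∣p∣≤2 λ {w} w∈S → ∈⁅x⁆∪⁅y⁆⁺ (v-or-u w w∈S))
              (two-members⇒2≤∣p∣ v∈S u∈S (u≢v ∘ sym)) ,
    adjacent
    where
    adjacent : ∀ x y → x ∈ S → y ∈ S → x ≢ y → Adj G x y
    adjacent x y x∈S y∈S x≢y with v-or-u x x∈S | v-or-u y y∈S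
    ... | inj₁ refl | _         = v-dominates y y∈S (x≢y ∘ sym)
    ... | _         | inj₁ refl = Adj-sym (v-dominates x x∈S x≢y)
    ... | inj₂ refl | inj₂ refl = contradiction refl x≢y

  dominating-vertex⇒γ≡γcer : ∀ {S v} → ¬ IsK2 G S → Dominates S v → GammaEqGammaCer G S
  dominating-vertex⇒γ≡γcer {S} {v} ¬K2 (v∈S , v-dominates) =
    certified-minimum⇒γ≡γcer (λ _ → nonempty⇒1≤γ (v , v∈S)) (dominating , certified) (∣⁅x⁆∣≡1 v)
    where
    dominating : DominatingIn G S ⁅ v ⁆
    dominating =
      (λ u∈⁅v⁆ → subst (_∈ S) (sym (x∈⁅y⁆⇒x≡y v u∈⁅v⁆)) v∈S) ,
      λ u u∈S u∉⁅v⁆ → v , x∈⁅x⁆ v , v-dominates u u∈S (x∉⁅y⁆⇒x≢y u∉⁅v⁆)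

    outside-count : ∣ N G v ∩ (S ─ ⁅ v ⁆) ∣ ≡ 0 ⊎ 2 ≤ ∣ N G v ∩ (S ─ ⁅ v ⁆) ∣
    outside-count with counterexample-or-all (_∈? S) (_≟ v)
    ... | inj₂ only-v = inj₁ (Empty⇒∣p∣≡0 λ (u , u∈) →
      let _ , u∈S , u∉⁅v⁆ = ∈N∩─⁻ u∈ in x∉⁅y⁆⇒x≢y u∉⁅v⁆ (only-v u u∈S))
    ... | inj₁ (u , u∈S , u≢v) with counterexample-or-all (_∈? S) (λ w → (w ≟ v) ⊎-dec (w ≟ u))
    ...   | inj₁ (w , w∈S , w≢v,u) =
      inj₂ (two-outside-neighbours (λ u≡w → w≢v,u (inj₂ (sym u≡w)))
              (v-dominates u u∈S u≢v) u∈S (x≢y⇒x∉⁅y⁆ u≢v)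
              (v-dominates w w∈S (w≢v,u ∘ inj₁)) w∈S (x≢y⇒x∉⁅y⁆ (w≢v,u ∘ inj₁)))
    ...   | inj₂ v-or-u = contradiction (dominating-vertex-with-one-other⇒K2 (v∈S , v-dominates) u∈S u≢v v-or-u) ¬K2

    certified : ∀ x → x ∈ ⁅ v ⁆ → ∣ N G x ∩ (S ─ ⁅ v ⁆) ∣ ≡ 0 ⊎ 2 ≤ ∣ N G x ∩ (S ─ ⁅ v ⁆) ∣
    certified x x∈⁅v⁆ with x∈⁅y⁆⇒x≡y v x∈⁅v⁆
    ... | refl = outside-count

  pair-certified : ∀ {S x y} → DominatingIn G S (⁅ x ⁆ ∪ ⁅ y ⁆) →
    2 ≤ ∣ N G x ∩ (S ─ (⁅ x ⁆ ∪ ⁅ y ⁆)) ∣ → 2 ≤ ∣ N G y ∩ (S ─ (⁅ x ⁆ ∪ ⁅ y ⁆)) ∣ →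
    CertifiedDominatingIn G S (⁅ x ⁆ ∪ ⁅ y ⁆)
  pair-certified {S} {x} {y} dominating x-outside y-outside = dominating , certified
    where
    certified : ∀ z → z ∈ ⁅ x ⁆ ∪ ⁅ y ⁆ →
                ∣ N G z ∩ (S ─ (⁅ x ⁆ ∪ ⁅ y ⁆)) ∣ ≡ 0 ⊎ 2 ≤ ∣ N G z ∩ (S ─ (⁅ x ⁆ ∪ ⁅ y ⁆)) ∣
    certified z z∈ with ∈⁅x⁆∪⁅y⁆⁻ z∈
    ... | inj₁ refl = inj₂ x-outside
    ... | inj₂ refl = inj₂ y-outside

  record Join (S : Subset n) : Set₁ where
    field
      Left Right : Fin n → Set
      Left?      : ∀ u → Dec (Left u)
      Right?     : ∀ u → Dec (Right u)
      Left⊆S     : ∀ {a} → Left a → a ∈ S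
      Right⊆S    : ∀ {b} → Right b → b ∈ S
      cover      : ∀ {z} → z ∈ S → Left z ⊎ Right z
      complete   : ∀ {a b} → Left a → Right b → Adj G a b
      left       : ∃ Left
      right      : ∃ Right

    Left≢Right : ∀ {a b} → Left a → Right b → a ≢ b
    Left≢Right La Rb = Adj⇒≢ (complete La Rb)

  swap : ∀ {S} → Join S → Join S
  swap J = record
    { Left = Right ; Right = Left ; Left? = Right? ; Right? = Left?
    ; Left⊆S = Right⊆S ; Right⊆S = Left⊆S ; cover = Sum.swap ∘ cover
    ; complete = λ Rb La → Adj-sym (complete La Rb) ; left = right ; right = left }
    where open Join J

  module _ {S : Subset n} (J : Join S) where
    open Join J

    another-left : (∀ v → ¬ Dominates S v) → ∀ {a} → Left a → ∃ λ a′ → Left a′ × a ≢ a′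
    another-left no-dominating La with non-neighbour (no-dominating _) (Left⊆S La)
    ... | u , (u∈S , u≢a) , ¬au with cover u∈S
    ...   | inj₁ Lu = u , Lu , u≢a ∘ sym
    ...   | inj₂ Ru = contradiction (complete La Ru) ¬au

    left-joined-to-two : ∀ {D a b b′} → Left a → Right b → Right b′ → b ≢ b′ → b ∉ D → b′ ∉ D →
                         2 ≤ ∣ N G a ∩ (S ─ D) ∣
    left-joined-to-two La Rb Rb′ b≢b′ b∉D b′∉D =
      two-outside-neighbours b≢b′ (complete La Rb) (Right⊆S Rb) b∉D (complete La Rb′) (Right⊆S Rb′) b′∉D

    left-pair-certified : ∀ {a₁ a₂ b₁ b₂} → Left a₁ → Left a₂ → (∀ z → Left z → z ≡ a₁ ⊎ z ≡ a₂) →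
                          Right b₁ → Right b₂ → b₁ ≢ b₂ → CertifiedDominatingIn G S (⁅ a₁ ⁆ ∪ ⁅ a₂ ⁆)
    left-pair-certified {a₁} {a₂} La₁ La₂ only-a₁,a₂ Rb₁ Rb₂ b₁≢b₂ =
      pair-certified (D⊆S , dominated) (joined-to-b₁,b₂ La₁) (joined-to-b₁,b₂ La₂)
      where
      D⊆S : ⁅ a₁ ⁆ ∪ ⁅ a₂ ⁆ ⊆ S
      D⊆S z∈D = [ (λ { refl → Left⊆S La₁ }) , (λ { refl → Left⊆S La₂ }) ]′ (∈⁅x⁆∪⁅y⁆⁻ z∈D)

      dominated : ∀ z → z ∈ S → z ∉ ⁅ a₁ ⁆ ∪ ⁅ a₂ ⁆ → Σ (Fin n) λ u → u ∈ ⁅ a₁ ⁆ ∪ ⁅ a₂ ⁆ × Adj G u z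
      dominated z z∈S z∉D with cover z∈S
      ... | inj₁ Lz = contradiction (∈⁅x⁆∪⁅y⁆⁺ (only-a₁,a₂ z Lz)) z∉D
      ... | inj₂ Rz = a₁ , ∈⁅x⁆∪⁅y⁆⁺ (inj₁ refl) , complete La₁ Rz

      right∉D : ∀ {b} → Right b → b ∉ ⁅ a₁ ⁆ ∪ ⁅ a₂ ⁆
      right∉D Rb = ∉⁅x⁆∪⁅y⁆ (Left≢Right La₁ Rb ∘ sym) (Left≢Right La₂ Rb ∘ sym)

      joined-to-b₁,b₂ : ∀ {a} → Left a → 2 ≤ ∣ N G a ∩ (S ─ (⁅ a₁ ⁆ ∪ ⁅ a₂ ⁆)) ∣
      joined-to-b₁,b₂ La = left-joined-to-two La Rb₁ Rb₂ b₁≢b₂ (right∉D Rb₁) (right∉D Rb₂)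

  module _ {S : Subset n} (J : Join S) {a₁ a₂ b₁ b₂ : Fin n}
           (La₁ : Join.Left J a₁) (La₂ : Join.Left J a₂) (a₁≢a₂ : a₁ ≢ a₂)
           (Rb₁ : Join.Right J b₁) (Rb₂ : Join.Right J b₂) (b₁≢b₂ : b₁ ≢ b₂) where
    open Join J

    private
      cross-pair-certified : ∀ {a₃ b₃} → Left a₃ → ¬ (a₃ ≡ a₁ ⊎ a₃ ≡ a₂) →
                             Right b₃ → ¬ (b₃ ≡ b₁ ⊎ b₃ ≡ b₂) → CertifiedDominatingIn G S (⁅ a₁ ⁆ ∪ ⁅ b₁ ⁆)
      cross-pair-certified {a₃} {b₃} La₃ a₃∉ Rb₃ b₃∉ =
        pair-certified (D⊆S , dominated)
          (left-joined-to-two J La₁ Rb₂ Rb₃ (λ b₂≡b₃ → b₃∉ (inj₂ (sym b₂≡b₃)))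
                              (right∉D Rb₂ (b₁≢b₂ ∘ sym)) (right∉D Rb₃ (b₃∉ ∘ inj₁)))
          (left-joined-to-two (swap J) Rb₁ La₂ La₃ (λ a₂≡a₃ → a₃∉ (inj₂ (sym a₂≡a₃)))
                              (left∉D La₂ (a₁≢a₂ ∘ sym)) (left∉D La₃ (a₃∉ ∘ inj₁)))
        where
        D⊆S : ⁅ a₁ ⁆ ∪ ⁅ b₁ ⁆ ⊆ S
        D⊆S z∈D = [ (λ { refl → Left⊆S La₁ }) , (λ { refl → Right⊆S Rb₁ }) ]′ (∈⁅x⁆∪⁅y⁆⁻ z∈D)

        dominated : ∀ z → z ∈ S → z ∉ ⁅ a₁ ⁆ ∪ ⁅ b₁ ⁆ → Σ (Fin n) λ u → u ∈ ⁅ a₁ ⁆ ∪ ⁅ b₁ ⁆ × Adj G u z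
        dominated z z∈S _ with cover z∈S
        ... | inj₁ Lz = b₁ , ∈⁅x⁆∪⁅y⁆⁺ (inj₂ refl) , Adj-sym (complete Lz Rb₁)
        ... | inj₂ Rz = a₁ , ∈⁅x⁆∪⁅y⁆⁺ (inj₁ refl) , complete La₁ Rz

        left∉D : ∀ {a} → Left a → a ≢ a₁ → a ∉ ⁅ a₁ ⁆ ∪ ⁅ b₁ ⁆
        left∉D La a≢a₁ = ∉⁅x⁆∪⁅y⁆ a≢a₁ (Left≢Right La Rb₁)

        right∉D : ∀ {b} → Right b → b ≢ b₁ → b ∉ ⁅ a₁ ⁆ ∪ ⁅ b₁ ⁆
        right∉D Rb b≢b₁ = ∉⁅x⁆∪⁅y⁆ (Left≢Right La₁ Rb ∘ sym) b≢b₁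

    certified-pair : ∃ λ D → CertifiedDominatingIn G S D × ∣ D ∣ ≡ 2
    certified-pair
      with counterexample-or-all Left? (λ z → (z ≟ a₁) ⊎-dec (z ≟ a₂))
         | counterexample-or-all Right? (λ z → (z ≟ b₁) ⊎-dec (z ≟ b₂))
    ... | inj₂ only-a₁,a₂ | _ =
      _ , left-pair-certified J La₁ La₂ only-a₁,a₂ Rb₁ Rb₂ b₁≢b₂ , ∣⁅x⁆∪⁅y⁆∣≡2 a₁≢a₂
    ... | inj₁ _ | inj₂ only-b₁,b₂ =
      _ , left-pair-certified (swap J) Rb₁ Rb₂ only-b₁,b₂ La₁ La₂ a₁≢a₂ , ∣⁅x⁆∪⁅y⁆∣≡2 b₁≢b₂
    ... | inj₁ (a₃ , La₃ , a₃∉) | inj₁ (b₃ , Rb₃ , b₃∉) =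
      _ , cross-pair-certified La₃ a₃∉ Rb₃ b₃∉ , ∣⁅x⁆∪⁅y⁆∣≡2 (Left≢Right La₁ Rb₁)

  join⇒γ≡γcer : ∀ {S} → Join S → (∀ v → ¬ Dominates S v) → GammaEqGammaCer G S
  join⇒γ≡γcer J no-dominating =
    let a₁ , La₁ = left
        a₂ , La₂ , a₁≢a₂ = another-left J no-dominating La₁
        b₁ , Rb₁ = right
        b₂ , Rb₂ , b₁≢b₂ = another-left (swap J) no-dominating Rb₁
        D , certified , ∣D∣≡2 = certified-pair J La₁ La₂ a₁≢a₂ Rb₁ Rb₂ b₁≢b₂
    in certified-minimum⇒γ≡γcer (λ _ → no-dominating-vertex⇒2≤γ (a₁ , Left⊆S La₁) no-dominating)
                                certified ∣D∣≡2
    where open Join J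

  module P4Free-join (p4-free : P4Free G) {S : Subset n} (connected : ConnectedIn G S)
                     (no-dominating : ∀ v → ¬ Dominates S v) where

    v : Fin n
    v = proj₁ (proj₁ connected)

    v∈S : v ∈ S
    v∈S = proj₂ (proj₁ connected)

    Near Far : Fin n → Set
    Near u = u ∈ S × Adj G v u
    Far u  = u ∈ S × u ≢ v × ¬ Adj G v u

    Near? : ∀ u → Dec (Near u)
    Near? u = (u ∈? S) ×-dec Adj? v u

    Far? : ∀ u → Dec (Far u)
    Far? u = (u ∈? S) ×-dec ¬? (u ≟ v) ×-dec ¬? (Adj? v u)

    trichotomy : ∀ {u} → u ∈ S → u ≡ v ⊎ Near u ⊎ Far u
    trichotomy {u} u∈S with u ≟ v | Adj? v u
    ... | yes u≡v | _        = inj₁ u≡v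
    ... | no u≢v  | yes vu   = inj₂ (inj₁ (u∈S , vu))
    ... | no u≢v  | no ¬vu   = inj₂ (inj₂ (u∈S , u≢v , ¬vu))

    infix 4 _≼_
    _≼_ : Fin n → Fin n → Set
    w ≼ w′ = ∀ x → Near x → Adj G x w → Adj G x w′

    ≼-trans : ∀ {w w′ w″} → w ≼ w′ → w′ ≼ w″ → w ≼ w″
    ≼-trans w≼w′ w′≼w″ x Nx xw = w′≼w″ x Nx (w≼w′ x Nx xw)

    far-edge⇒≼ : ∀ {w w′} → Far w → Far w′ → Adj G w w′ → w′ ≼ w
    far-edge⇒≼ {w} (_ , _ , ¬vw) (_ , _ , ¬vw′) ww′ x (_ , vx) xw′ =
      decidable-stable (Adj? x w) λ ¬xw →
        p4-free w _ x v (induced-P4 ww′ (Adj-sym xw′) (Adj-sym vx)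
                                    (¬xw ∘ Adj-sym) (¬vw′ ∘ Adj-sym) (¬vw ∘ Adj-sym))

    near-nbrs-of-far⇒adjacent : ∀ {w b x} → Far w → Near b → Near x →
                                Adj G b w → ¬ Adj G x w → Adj G b x
    near-nbrs-of-far⇒adjacent {w} {b} {x} (_ , _ , ¬vw) (_ , vb) (_ , vx) bw ¬xw =
      decidable-stable (Adj? b x) λ ¬bx →
        p4-free w b v x (induced-P4 (Adj-sym bw) (Adj-sym vb) vx (¬vw ∘ Adj-sym) ¬bx (¬xw ∘ Adj-sym))

    ≼-total : ∀ {w w′} → Far w → Far w′ → w ≼ w′ ⊎ w′ ≼ w
    ≼-total {w} {w′} Fw Fw′
      with counterexample-or-all (λ x → Near? x ×-dec Adj? x w) (λ x → Adj? x w′)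
    ... | inj₂ w≼w′ = inj₁ λ x Nx xw → w≼w′ x (Nx , xw)
    ... | inj₁ (x , (Nx , xw) , ¬xw′) = inj₂ w′≼w
      where
      w′≼w : w′ ≼ w
      w′≼w y Ny yw′ = decidable-stable (Adj? y w) λ ¬yw →
        let xy = near-nbrs-of-far⇒adjacent Fw Nx Ny xw ¬yw in
        [ (λ ww′ → ¬xw′ (far-edge⇒≼ Fw′ Fw (Adj-sym ww′) x Nx xw))
        , (λ ¬ww′ → p4-free w x y w′ (induced-P4 (Adj-sym xw) xy yw′ (¬yw ∘ Adj-sym) ¬xw′ ¬ww′))
        ]′ (toSum (Adj? w w′))

    far-has-near-nbr : ∀ {w} → WalkIn G S w v → Far w → ∃ λ x → Near x × Adj G x w
    far-has-near-nbr (here _) (_ , v≢v , _) = contradiction refl v≢v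
    far-has-near-nbr (step {w = w′} _ ww′ walk) Fw with trichotomy (walk-start walk)
    ... | inj₁ refl       = contradiction (Adj-sym ww′) (proj₂ (proj₂ Fw))
    ... | inj₂ (inj₁ Nw′) = w′ , Nw′ , Adj-sym ww′
    ... | inj₂ (inj₂ Fw′) =
      let x , Nx , xw′ = far-has-near-nbr walk Fw′ in x , Nx , far-edge⇒≼ Fw Fw′ ww′ x Nx xw′

    Hub : Fin n → Set
    Hub u = Near u × (∀ w → Far w → Adj G u w)

    Hub? : ∀ u → Dec (Hub u)
    Hub? u = Near? u ×-dec all? (λ w → Far? w →-dec Adj? u w)

    hub : ∃ Hub
    hub =
      let w₀ , (w₀∈S , w₀≢v) , ¬vw₀ = non-neighbour (no-dominating v) v∈S
          wₘ , Fwₘ , wₘ-least      = minimum Far? _≼_ ≼-trans ≼-total (w₀ , w₀∈S , w₀≢v , ¬vw₀)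
          x , Nx , xwₘ             = far-has-near-nbr (proj₂ connected wₘ v (proj₁ Fwₘ) v∈S) Fwₘ
      in x , Nx , λ w Fw → wₘ-least w Fw x Nx xwₘ

    NonHub : Fin n → Set
    NonHub u = u ∈ S × ¬ Hub u

    nonHub-adjacent-to-hub : ∀ {a b} → NonHub a → Hub b → Adj G a b
    nonHub-adjacent-to-hub {a} (a∈S , ¬Ha) (Nb , b-far) with trichotomy a∈S
    ... | inj₁ refl       = proj₂ Nb
    ... | inj₂ (inj₂ Fa) = Adj-sym (b-far a Fa)
    ... | inj₂ (inj₁ Na) with counterexample-or-all Far? (Adj? a)
    ...   | inj₁ (w , Fw , ¬aw) = Adj-sym (near-nbrs-of-far⇒adjacent Fw Nb Na (b-far w Fw) ¬aw)
    ...   | inj₂ a-far          = contradiction (Na , a-far) ¬Ha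

    join : Join S
    join = record
      { Left = NonHub ; Right = Hub
      ; Left? = λ u → (u ∈? S) ×-dec ¬? (Hub? u) ; Right? = Hub?
      ; Left⊆S = proj₁ ; Right⊆S = proj₁ ∘ proj₁
      ; cover = λ {z} z∈S → [ inj₂ , (λ ¬Hz → inj₁ (z∈S , ¬Hz)) ]′ (toSum (Hub? z))
      ; complete = nonHub-adjacent-to-hub
      ; left = v , v∈S , λ Hv → Adj-irrefl (proj₂ (proj₁ Hv))
      ; right = hub
      }

  P4Free⇒γγcer-perfect : P4Free G → GGcerPerfect G
  P4Free⇒γγcer-perfect p4-free S connected ¬K2 with any? (Dominates? S)
  ... | yes (v , v-dominates) = dominating-vertex⇒γ≡γcer ¬K2 v-dominates
  ... | no ∄dominating        =
    join⇒γ≡γcer (P4Free-join.join p4-free connected no-dominating) no-dominating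
    where
    no-dominating : ∀ v → ¬ Dominates S v
    no-dominating v v-dominates = ∄dominating (v , v-dominates)

  record InducesP4 (S : Subset n) (a b c d : Fin n) : Set where
    field
      a∈S : a ∈ S
      b∈S : b ∈ S
      c∈S : c ∈ S
      d∈S : d ∈ S
      cover : ∀ {x} → x ∈ S → x ≡ a ⊎ x ≡ b ⊎ x ≡ c ⊎ x ≡ d
      ab : Adj G a b
      bc : Adj G b c
      cd : Adj G c d
      ¬ac : ¬ Adj G a c
      ¬bd : ¬ Adj G b d
      ¬ad : ¬ Adj G a d

  InducesP4-reverse : ∀ {S a b c d} → InducesP4 S a b c d → InducesP4 S d c b a
  InducesP4-reverse {S} {a} {b} {c} {d} P = record
    { a∈S = d∈S ; b∈S = c∈S ; c∈S = b∈S ; d∈S = a∈S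
    ; cover = cover′
    ; ab = Adj-sym cd ; bc = Adj-sym bc ; cd = Adj-sym ab
    ; ¬ac = ¬bd ∘ Adj-sym ; ¬bd = ¬ac ∘ Adj-sym ; ¬ad = ¬ad ∘ Adj-sym
    }
    where
    open InducesP4 P
    cover′ : ∀ {x} → x ∈ S → x ≡ d ⊎ x ≡ c ⊎ x ≡ b ⊎ x ≡ a
    cover′ x∈S with cover x∈S
    ... | inj₁ x≡a                 = inj₂ (inj₂ (inj₂ x≡a))
    ... | inj₂ (inj₁ x≡b)          = inj₂ (inj₂ (inj₁ x≡b))
    ... | inj₂ (inj₂ (inj₁ x≡c))   = inj₂ (inj₁ x≡c)
    ... | inj₂ (inj₂ (inj₂ x≡d))   = inj₁ x≡d

  module _ {S a b c d} (P : InducesP4 S a b c d) where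
    open InducesP4 P

    induces-P4-connected : ConnectedIn G S
    induces-P4-connected = reaching⇒connected a∈S walk-to-a
      where
      walk-to-a : ∀ {x} → x ∈ S → WalkIn G S x a
      walk-to-a x∈S with cover x∈S
      ... | inj₁ refl                 = here a∈S
      ... | inj₂ (inj₁ refl)          = step b∈S (Adj-sym ab) (here a∈S)
      ... | inj₂ (inj₂ (inj₁ refl))   = step c∈S (Adj-sym bc) (step b∈S (Adj-sym ab) (here a∈S))
      ... | inj₂ (inj₂ (inj₂ refl))   =
        step d∈S (Adj-sym cd) (step c∈S (Adj-sym bc) (step b∈S (Adj-sym ab) (here a∈S)))

    induces-P4-¬K2 : ¬ IsK2 G S
    induces-P4-¬K2 (_ , adjacent) = ¬ac (adjacent a c a∈S c∈S λ { refl → ¬ad cd })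

    induces-P4-γ≤2 : ∀ {k} → (∀ D → DominatingIn G S D → k ≤ ∣ D ∣) → k ≤ 2
    induces-P4-γ≤2 lower-bound =
      ≤-trans (lower-bound _ (D⊆S , dominated)) (≤-reflexive (∣⁅x⁆∪⁅y⁆∣≡2 (Adj⇒≢ bc)))
      where
      D⊆S : ⁅ b ⁆ ∪ ⁅ c ⁆ ⊆ S
      D⊆S z∈D = [ (λ { refl → b∈S }) , (λ { refl → c∈S }) ]′ (∈⁅x⁆∪⁅y⁆⁻ z∈D)

      dominated : ∀ z → z ∈ S → z ∉ ⁅ b ⁆ ∪ ⁅ c ⁆ → Σ (Fin n) λ u → u ∈ ⁅ b ⁆ ∪ ⁅ c ⁆ × Adj G u z
      dominated z z∈S z∉D with cover z∈S
      ... | inj₁ refl               = b , ∈⁅x⁆∪⁅y⁆⁺ (inj₁ refl) , Adj-sym ab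
      ... | inj₂ (inj₁ refl)        = contradiction (∈⁅x⁆∪⁅y⁆⁺ (inj₁ refl)) z∉D
      ... | inj₂ (inj₂ (inj₁ refl)) = contradiction (∈⁅x⁆∪⁅y⁆⁺ (inj₂ refl)) z∉D
      ... | inj₂ (inj₂ (inj₂ refl)) = c , ∈⁅x⁆∪⁅y⁆⁺ (inj₂ refl) , cd

    a-nbr : ∀ {z} → z ∈ S → Adj G a z → z ≡ b
    a-nbr z∈S az with cover z∈S
    ... | inj₁ refl               = contradiction az Adj-irrefl
    ... | inj₂ (inj₁ z≡b)         = z≡b
    ... | inj₂ (inj₂ (inj₁ refl)) = contradiction az ¬ac
    ... | inj₂ (inj₂ (inj₂ refl)) = contradiction az ¬ad

    b-nbr : ∀ {z} → z ∈ S → Adj G b z → z ≡ a ⊎ z ≡ c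
    b-nbr z∈S bz with cover z∈S
    ... | inj₁ z≡a                = inj₁ z≡a
    ... | inj₂ (inj₁ refl)        = contradiction bz Adj-irrefl
    ... | inj₂ (inj₂ (inj₁ z≡c))  = inj₂ z≡c
    ... | inj₂ (inj₂ (inj₂ refl)) = contradiction bz ¬bd

    d-nbr : ∀ {z} → z ∈ S → Adj G d z → z ≡ c
    d-nbr z∈S dz with cover z∈S
    ... | inj₁ refl               = contradiction (Adj-sym dz) ¬ad
    ... | inj₂ (inj₁ refl)        = contradiction (Adj-sym dz) ¬bd
    ... | inj₂ (inj₂ (inj₁ z≡c))  = z≡c
    ... | inj₂ (inj₂ (inj₂ refl)) = contradiction dz Adj-irrefl

    module _ {D} (certified : CertifiedDominatingIn G S D) where
      private
        D⊆S : D ⊆ S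
        D⊆S = proj₁ (proj₁ certified)
        dominated : ∀ z → z ∈ S → z ∉ D → Σ (Fin n) λ u → u ∈ D × Adj G u z
        dominated = proj₂ (proj₁ certified)

      third∈certified : c ∈ D
      third∈certified = decidable-stable (c ∈? D) λ c∉D → case-d c∉D (toSum (d ∈? D))
        where
        case-d : c ∉ D → d ∈ D ⊎ d ∉ D → ⊥
        case-d c∉D (inj₁ d∈D) =
          certified⇒¬unique-outside-neighbour certified d∈D (Adj-sym cd) c∈S c∉D
            λ dz z∈S _ → d-nbr z∈S dz
        case-d c∉D (inj₂ d∉D) =
          let u , u∈D , ud = dominated d d∈S d∉D
          in c∉D (subst (_∈ D) (d-nbr (D⊆S u∈D) (Adj-sym ud)) u∈D)

      first∈certified : a ∈ D
      first∈certified = decidable-stable (a ∈? D) λ a∉D →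
        let u , u∈D , ua = dominated a a∈S a∉D
            b∈D          = subst (_∈ D) (a-nbr (D⊆S u∈D) (Adj-sym ua)) u∈D
        in certified⇒¬unique-outside-neighbour certified b∈D (Adj-sym ab) a∈S a∉D
             λ bz z∈S z∉D → [ id , (λ { refl → contradiction third∈certified z∉D }) ]′ (b-nbr z∈S bz)

  four-vertices-induce-P4 : ∀ {a b c d} → InducedP4 G a b c d →
                            InducesP4 ((⁅ a ⁆ ∪ ⁅ b ⁆) ∪ (⁅ c ⁆ ∪ ⁅ d ⁆)) a b c d
  four-vertices-induce-P4 (_ , _ , _ , _ , _ , _ , ab , bc , cd , ¬ac , ¬bd , ¬ad) = record
    { a∈S = x∈p∪q⁺ (inj₁ (∈⁅x⁆∪⁅y⁆⁺ (inj₁ refl))) ; b∈S = x∈p∪q⁺ (inj₁ (∈⁅x⁆∪⁅y⁆⁺ (inj₂ refl)))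
    ; c∈S = x∈p∪q⁺ (inj₂ (∈⁅x⁆∪⁅y⁆⁺ (inj₁ refl))) ; d∈S = x∈p∪q⁺ (inj₂ (∈⁅x⁆∪⁅y⁆⁺ (inj₂ refl)))
    ; cover = λ x∈S → [ Sum.map₂ inj₁ ∘ ∈⁅x⁆∪⁅y⁆⁻ , inj₂ ∘ inj₂ ∘ ∈⁅x⁆∪⁅y⁆⁻ ]′ (x∈p∪q⁻ _ _ x∈S)
    ; ab = ab ; bc = bc ; cd = cd ; ¬ac = ¬ac ; ¬bd = ¬bd ; ¬ad = ¬ad
    }

  γγcer-perfect⇒P4Free : GGcerPerfect G → P4Free G
  γγcer-perfect⇒P4Free perfect a b c d p4@(a≢b , a≢c , _ , b≢c , _) =
    let P = four-vertices-induce-P4 p4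
        k , (_ , lower-bound) , ((D , certified , ∣D∣≡k) , _) =
          perfect _ (induces-P4-connected P) (induces-P4-¬K2 P)
        open ≤-Reasoning
    in contradiction
         (begin
            3     ≤⟨ three-members⇒3≤∣p∣ (first∈certified P certified)
                                         (third∈certified (InducesP4-reverse P) certified)
                                         (third∈certified P certified) a≢b a≢c b≢c ⟩
            ∣ D ∣ ≡⟨ ∣D∣≡k ⟩
            k     ≤⟨ induces-P4-γ≤2 P lower-bound ⟩
            2     ∎)
         λ { (s≤s (s≤s ())) }

corollary2p8 : ∀ (n : ℕ) (G : Graph n) → GGcerPerfect G ⇔ P4Free G
corollary2p8 n G = mk⇔ (γγcer-perfect⇒P4Free G) (P4Free⇒γγcer-perfect G)
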